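{- Both $\textsf{fin}$ and $\textsf{rcp}$ satisfy the diagonal intersection property.
   Context: $\mathbb{N}$ is the set of positive integers. $\textsf{fin}$ is the family of finite subsets of $\mathbb{N}$; $\textsf{rcp}=\{A\subseteq\mathbb{N}\mid\sum_{a\in A}1/a<\infty\}$. An ideal $\mathcal{I}\subseteq\mathcal{P}(\mathbb{N})$ has the diagonal intersection property if for every sequence $\langle B_n\mid n\in\mathbb{N}\rangle$ with $B_n\notin\mathcal{I}$ and $B_{n+1}\setminus B_n\in\mathcal{I}$ for all $n$, there exists $A\notin\mathcal{I}$ with $A\setminus B_n\in\mathcal{I}$ for all $n$. -}

module Defs where

open import Data.Nat using (ℕ; zero; suc; _<_)
open import Data.Bool using (Bool; true; false; _∧_; not)
open import Data.Integer using (+_)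
open import Data.Rational using (ℚ; 0ℚ; _+_; _/_; _≤_)
open import Data.Product using (Σ; ∃; _×_)
open import Relation.Nullary using (¬_)
open import Relation.Binary.PropositionalEquality using (_≡_)

-- A subset of the positive integers ℕ⁺ = {1,2,3,...}.
-- Convention: X : Subset, and X m ≡ true means that the positive
-- integer (suc m) belongs to the set.  (Characteristic functions;
-- classically every subset has one.)
Subset : Set
Subset = ℕ → Bool

_∈_ : ℕ → Subset → Set
m ∈ X = X m ≡ true

_∖_ : Subset → Subset → Subset
(X ∖ Y) m = X m ∧ not (Y m)

Family : Set₁
Family = Subset → Set

fin : Family
fin X = ∃ λ N → ∀ m → m ∈ X → m < N

recip : ℕ → ℚ
recip m = + 1 / suc m

-- partial sum  Σ_{a ∈ X, a ≤ n} 1/a   (a = suc m with m < n)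
psum : Subset → ℕ → ℚ
psum X zero = 0ℚ
psum X (suc n) with X n
... | true  = psum X n + recip n
... | false = psum X n

-- rcp: Σ_{a ∈ X} 1/a < ∞, i.e. (terms are nonnegative) the partial
-- sums are bounded.
rcp : Family
rcp X = ∃ λ M → ∀ n → psum X n ≤ M

DiagonalIntersectionProperty : Family → Set
DiagonalIntersectionProperty I =
  (B : ℕ → Subset) →
  (∀ n → ¬ I (B n)) →
  (∀ n → I (B (suc n) ∖ B n)) →
  Σ Subset λ A → ¬ I A × (∀ n → I (A ∖ B n))

module Submission where

-- Both fin and rcp are ideals I that contain every bounded set and come with
-- a notion of an I-heavy interval [L, R) of a set (for fin: the interval
-- meets the set; for rcp: the reciprocals of the set's elements in the
-- interval add up to at least 1) such that
--   * a set outside I has a heavy interval beyond every point,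
--   * heaviness is monotone in the part of the set inside the interval,
--   * a set that is heavy on a sequence of disjoint intervals running off
--     to infinity lies outside I.
-- Every such "heavy-interval ideal" has the diagonal intersection property:
-- the sets C n = B 0 ∩ ⋯ ∩ B n differ from B n by a set in I, so they lie
-- outside I; pick consecutive heavy intervals [L n, R n) for C n and let A be
-- the union of the pieces C n ∩ [L n, R n).  Then A is heavy on every
-- interval, so A ∉ I, while A ∖ B k ⊆ [0, R k) since the pieces with n ≥ k
-- lie in B k.  The file develops the set algebra, the abstract argument,
-- and then checks the axioms for fin and for rcp (the latter via partial
-- sums of reciprocals and the Archimedean property of ℚ).  Excluded middle
-- is needed both to define A and to locate heavy intervals.

open import Defs
open import Level using (0ℓ)
open import Axiom.ExcludedMiddle using (ExcludedMiddle)
open import Data.Product using (∃; _×_; _,_; proj₁; proj₂)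

module SetAlgebra where
  open import Data.Nat using (ℕ)
  open import Data.Bool using (true; false; _∧_; _∨_)
  open import Data.Sum using (_⊎_; inj₁; inj₂)
  open import Data.Empty using (⊥; ⊥-elim)
  open import Relation.Nullary using (contradiction)
  open import Relation.Binary.PropositionalEquality using (_≡_; refl; sym; trans)

  _∉_ : ℕ → Subset → Set
  m ∉ X = X m ≡ false

  _⊆_ : Subset → Subset → Set
  X ⊆ Y = ∀ m → m ∈ X → m ∈ Y

  _∪_ : Subset → Subset → Subset
  (X ∪ Y) m = X m ∨ Y m

  _∩_ : Subset → Subset → Subset
  (X ∩ Y) m = X m ∧ Y m

  ∈-or-∉ : ∀ X m → m ∈ X ⊎ m ∉ X
  ∈-or-∉ X m with X m
  ... | true  = inj₁ refl
  ... | false = inj₂ refl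

  ∈∉-absurd : ∀ {X m} → m ∈ X → m ∉ X → ⊥
  ∈∉-absurd m∈X m∉X = contradiction (trans (sym m∈X) m∉X) λ ()

  ∈∖ : ∀ {X Y m} → m ∈ (X ∖ Y) → m ∈ X × m ∉ Y
  ∈∖ {X} {Y} {m} _ with X m | Y m
  ... | true | false = refl , refl
  ∈∖ () | true  | true
  ∈∖ () | false | _

  ∖-intro : ∀ {X Y m} → m ∈ X → m ∉ Y → m ∈ (X ∖ Y)
  ∖-intro m∈X m∉Y rewrite m∈X | m∉Y = refl

  ∈∩ : ∀ {X Y m} → m ∈ (X ∩ Y) → m ∈ X × m ∈ Y
  ∈∩ {X} {Y} {m} _ with X m | Y m
  ... | true | true = refl , refl
  ∈∩ () | true  | false
  ∈∩ () | false | _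

  ∩-intro : ∀ {X Y m} → m ∈ X → m ∈ Y → m ∈ (X ∩ Y)
  ∩-intro m∈X m∈Y rewrite m∈X | m∈Y = refl

  ∪-introˡ : ∀ {X Y m} → m ∈ X → m ∈ (X ∪ Y)
  ∪-introˡ m∈X rewrite m∈X = refl

  ∪-introʳ : ∀ {X Y m} → m ∈ Y → m ∈ (X ∪ Y)
  ∪-introʳ {X} {m = m} m∈Y with X m
  ... | true  = refl
  ... | false = m∈Y

  ∈∪ : ∀ {X Y m} → m ∈ (X ∪ Y) → m ∈ X ⊎ m ∈ Y
  ∈∪ {X} {m = m} m∈ with X m
  ... | true  = inj₁ refl
  ... | false = inj₂ m∈

  ∖-self : ∀ X m → m ∈ (X ∖ X) → ⊥
  ∖-self X m m∈ = let (m∈X , m∉X) = ∈∖ {X} {X} m∈ in ∈∉-absurd {X} m∈X m∉X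

  ⊆-∪-∖ : ∀ X Y → X ⊆ (Y ∪ (X ∖ Y))
  ⊆-∪-∖ X Y m m∈X with ∈-or-∉ Y m
  ... | inj₁ m∈Y = ∪-introˡ {Y} {X ∖ Y} m∈Y
  ... | inj₂ m∉Y = ∪-introʳ {Y} {X ∖ Y} (∖-intro {X} {Y} m∈X m∉Y)

  ∖-triangle : ∀ X Y Z → (X ∖ Z) ⊆ ((X ∖ Y) ∪ (Y ∖ Z))
  ∖-triangle X Y Z m m∈ with ∈∖ {X} {Z} m∈ | ∈-or-∉ Y m
  ... | _ , m∉Z | inj₁ m∈Y = ∪-introʳ {X ∖ Y} {Y ∖ Z} (∖-intro {Y} {Z} m∈Y m∉Z)
  ... | m∈X , _ | inj₂ m∉Y = ∪-introˡ {X ∖ Y} {Y ∖ Z} (∖-intro {X} {Y} m∈X m∉Y)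

  ∖-∩ : ∀ X Z → (X ∖ (X ∩ Z)) ⊆ (X ∖ Z)
  ∖-∩ X Z m m∈ with ∈∖ {X} {X ∩ Z} m∈ | ∈-or-∉ Z m
  ... | m∈X , m∉X∩Z | inj₁ m∈Z = ⊥-elim (∈∉-absurd {X ∩ Z} (∩-intro {X} {Z} m∈X m∈Z) m∉X∩Z)
  ... | m∈X , _     | inj₂ m∉Z = ∖-intro {X} {Z} m∈X m∉Z

open SetAlgebra

module HeavyIntervals where
  open import Data.Nat using (ℕ; zero; suc; _≤_; _<_; z≤n; s≤s; _≤′_; ≤′-refl; ≤′-step)
  open import Data.Nat.Properties using (≤-refl; ≤-trans; ≤-total; n≤1+n; <-≤-trans; ≤⇒≤′)
  open import Data.Bool using (Bool; true)
  open import Data.Sum using (inj₁; inj₂)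
  open import Data.Empty using (⊥-elim)
  open import Relation.Nullary using (¬_; does; yes; no)
  open import Relation.Nullary.Decidable using (dec-true)
  open import Relation.Binary.PropositionalEquality using (_≡_)

  record IntervalSequence : Set where
    field
      left right : ℕ → ℕ
      index≤left : ∀ n → n ≤ left n
      right≤left : ∀ n → right n ≤ left (suc n)

  open IntervalSequence

  record HeavyIntervalIdeal (I : Family) : Set₁ where
    field
      downward     : ∀ {X Y} → X ⊆ Y → I Y → I X
      ∪-closed     : ∀ {X Y} → I X → I Y → I (X ∪ Y)
      bounded∈     : ∀ {X} N → (∀ m → m ∈ X → m < N) → I X
      Heavy        : Subset → ℕ → ℕ → Set
      heavy-beyond : ∀ {X} → ¬ I X → ∀ L → ∃ λ R → L ≤ R × Heavy X L R
      heavy-mono   : ∀ {X Y L R} → (∀ m → L ≤ m → m < R → m ∈ X → m ∈ Y) →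
                     Heavy X L R → Heavy Y L R
      heavy-often⇒∉ : ∀ {A} (J : IntervalSequence) →
                      (∀ n → Heavy A (left J n) (right J n)) → ¬ I A

    ∖-trans : ∀ {X Y Z} → I (X ∖ Y) → I (Y ∖ Z) → I (X ∖ Z)
    ∖-trans {X} {Y} {Z} X∖Y∈I Y∖Z∈I = downward (∖-triangle X Y Z) (∪-closed X∖Y∈I Y∖Z∈I)

    ∉-transfer : ∀ {X Y} → ¬ I X → I (X ∖ Y) → ¬ I Y
    ∉-transfer {X} {Y} X∉I X∖Y∈I Y∈I = X∉I (downward (⊆-∪-∖ X Y) (∪-closed Y∈I X∖Y∈I))

  module DiagonalIntersection (lem : ExcludedMiddle 0ℓ) {I : Family}
                              (ideal : HeavyIntervalIdeal I) where
    open HeavyIntervalIdeal ideal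

    decide : Set → Bool
    decide P = does (lem {P})

    decide-sound : ∀ {P} → decide P ≡ true → P
    decide-sound {P} with lem {P}
    ... | yes p = λ _ → p
    ... | no _  = λ ()

    module Construction (B : ℕ → Subset) (B∉I : ∀ n → ¬ I (B n))
                        (B-steps : ∀ n → I (B (suc n) ∖ B n)) where

      C : ℕ → Subset
      C zero    = B zero
      C (suc n) = B (suc n) ∩ C n

      B∖C∈I : ∀ n → I (B n ∖ C n)
      B∖C∈I zero    = bounded∈ 0 λ m m∈ → ⊥-elim (∖-self (B zero) m m∈)
      B∖C∈I (suc n) = downward (∖-∩ (B (suc n)) (C n))
                               (∖-trans {B (suc n)} {B n} {C n} (B-steps n) (B∖C∈I n))

      C∉I : ∀ n → ¬ I (C n)
      C∉I n = ∉-transfer (B∉I n) (B∖C∈I n)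

      C⊆B : ∀ {k n} → k ≤′ n → C n ⊆ B k
      C⊆B {n = zero}  ≤′-refl m m∈ = m∈
      C⊆B {n = suc n} ≤′-refl m m∈ = proj₁ (∈∩ {B (suc n)} {C n} m∈)
      C⊆B {n = suc n} (≤′-step k≤′n) m m∈ = C⊆B k≤′n m (proj₂ (∈∩ {B (suc n)} {C n} m∈))

      heavy-window : ∀ n l → ∃ λ r → l ≤ r × Heavy (C n) l r
      heavy-window n = heavy-beyond (C∉I n)

      L R : ℕ → ℕ
      L zero    = 0
      L (suc n) = suc (R n)
      R n = proj₁ (heavy-window n (L n))

      L≤R : ∀ n → L n ≤ R n
      L≤R n = proj₁ (proj₂ (heavy-window n (L n)))

      C-heavy : ∀ n → Heavy (C n) (L n) (R n)
      C-heavy n = proj₂ (proj₂ (heavy-window n (L n)))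

      index≤L : ∀ n → n ≤ L n
      index≤L zero    = z≤n
      index≤L (suc n) = s≤s (≤-trans (index≤L n) (L≤R n))

      R-mono : ∀ {k n} → k ≤′ n → R k ≤ R n
      R-mono ≤′-refl          = ≤-refl
      R-mono (≤′-step k≤′n) = ≤-trans (R-mono k≤′n) (≤-trans (n≤1+n _) (L≤R _))

      windows : IntervalSequence
      windows = record { left = L ; right = R
                       ; index≤left = index≤L ; right≤left = λ n → n≤1+n (R n) }

      InPiece : ℕ → Set
      InPiece m = ∃ λ n → L n ≤ m × m < R n × m ∈ C n

      A : Subset
      A m = decide (InPiece m)

      -- A contains C n on [L n, R n), so it is heavy on every window.
      A∉I : ¬ I A
      A∉I = heavy-often⇒∉ windows λ n →
        heavy-mono (λ m l≤m m<r m∈C → dec-true lem (n , l≤m , m<r , m∈C)) (C-heavy n)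

      -- A pieces with n ≥ k lie in C n ⊆ B k; the others lie below R k.
      A∖B∈I : ∀ k → I (A ∖ B k)
      A∖B∈I k = bounded∈ (R k) below
        where
        below : ∀ m → m ∈ (A ∖ B k) → m < R k
        below m m∈ with ∈∖ {A} {B k} m∈
        ... | m∈A , m∉B with decide-sound m∈A
        ... | n , _ , m<r , m∈C with ≤-total k n
        ... | inj₁ k≤n = ⊥-elim (∈∉-absurd {B k} (C⊆B (≤⇒≤′ k≤n) m m∈C) m∉B)
        ... | inj₂ n≤k = <-≤-trans m<r (R-mono (≤⇒≤′ n≤k))

    diagonal-intersection : DiagonalIntersectionProperty I
    diagonal-intersection B B∉I B-steps = A , A∉I , A∖B∈I
      where open Construction B B∉I B-steps

open HeavyIntervals

module FiniteSets (lem : ExcludedMiddle 0ℓ) where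
  open import Data.Nat using (ℕ; suc; _≤_; _<_; _⊔_)
  open import Data.Nat.Properties using (≤-refl; ≤-trans; n≤1+n; ≰⇒>; ≤⇒≯; <-≤-trans; m≤m⊔n; m≤n⊔m)
  open import Data.Sum using (inj₁; inj₂)
  open import Data.Empty using (⊥-elim)
  open import Relation.Nullary using (¬_; yes; no)
  open IntervalSequence

  Meets : Subset → ℕ → ℕ → Set
  Meets X L R = ∃ λ m → L ≤ m × m < R × m ∈ X

  fin-∪ : ∀ {X Y} → fin X → fin Y → fin (X ∪ Y)
  fin-∪ {X} {Y} (N₁ , X<N₁) (N₂ , Y<N₂) = N₁ ⊔ N₂ , bound
    where
    bound : ∀ m → m ∈ (X ∪ Y) → m < N₁ ⊔ N₂
    bound m m∈ with ∈∪ {X} {Y} m∈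
    ... | inj₁ m∈X = <-≤-trans (X<N₁ m m∈X) (m≤m⊔n N₁ N₂)
    ... | inj₂ m∈Y = <-≤-trans (Y<N₂ m m∈Y) (m≤n⊔m N₁ N₂)

  infinite-beyond : ∀ {X} → ¬ fin X → ∀ L → ∃ λ m → L ≤ m × m ∈ X
  infinite-beyond {X} X-infinite L with lem {∃ λ m → L ≤ m × m ∈ X}
  ... | yes found = found
  ... | no none   = ⊥-elim (X-infinite (L , λ m m∈X → ≰⇒> λ L≤m → none (m , L≤m , m∈X)))

  meets-beyond : ∀ {X} → ¬ fin X → ∀ L → ∃ λ R → L ≤ R × Meets X L R
  meets-beyond X-infinite L =
    let (m , L≤m , m∈X) = infinite-beyond X-infinite L
    in suc m , ≤-trans L≤m (n≤1+n m) , m , L≤m , ≤-refl , m∈X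

  meets-often⇒infinite : ∀ {A} (J : IntervalSequence) →
                         (∀ n → Meets A (left J n) (right J n)) → ¬ fin A
  meets-often⇒infinite J meets (N , A<N) =
    let (m , l≤m , _ , m∈A) = meets N
    in ≤⇒≯ (≤-trans (index≤left J N) l≤m) (A<N m m∈A)

  fin-ideal : HeavyIntervalIdeal fin
  fin-ideal = record
    { downward      = λ X⊆Y (N , Y<N) → N , λ m m∈X → Y<N m (X⊆Y m m∈X)
    ; ∪-closed      = fin-∪
    ; bounded∈      = λ N X<N → N , X<N
    ; Heavy         = Meets
    ; heavy-beyond  = meets-beyond
    ; heavy-mono    = λ X⊆Y (m , L≤m , m<R , m∈X) → m , L≤m , m<R , X⊆Y m L≤m m<R m∈X
    ; heavy-often⇒∉ = meets-often⇒infinite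
    }

module Archimedean where
  open import Data.Nat as ℕ using (ℕ; zero; suc)
  import Data.Nat.Properties as ℕₚ
  open import Data.Integer as ℤ using (+_; -[1+_]; ∣_∣)
  import Data.Integer.Properties as ℤₚ
  open import Data.Integer.Tactic.RingSolver using (solve-∀)
  open import Data.Rational using (ℚ; mkℚ; 0ℚ; 1ℚ; _+_; _≤_; _<_; toℚᵘ)
  open import Data.Rational.Properties using (≤-trans; <-≤-trans; +-monoˡ-≤; toℚᵘ-homo-+; toℚᵘ-cancel-<)
  import Data.Rational.Unnormalised as ℚᵘ
  import Data.Rational.Unnormalised.Properties as ℚᵘₚ
  open import Relation.Binary.PropositionalEquality using (_≡_)

  ones : ℕ → ℚ
  ones zero    = 0ℚ
  ones (suc n) = ones n + 1ℚ

  ones-unnormalised : ∀ n → toℚᵘ (ones n) ℚᵘ.≃ ℚᵘ.mkℚᵘ (+ n) 0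
  ones-unnormalised zero    = ℚᵘₚ.≃-refl
  ones-unnormalised (suc n) = begin
    toℚᵘ (ones n + 1ℚ)            ≈⟨ toℚᵘ-homo-+ (ones n) 1ℚ ⟩
    toℚᵘ (ones n) ℚᵘ.+ toℚᵘ 1ℚ    ≈⟨ ℚᵘₚ.+-cong (ones-unnormalised n) (ℚᵘₚ.≃-refl {toℚᵘ 1ℚ}) ⟩
    ℚᵘ.mkℚᵘ (+ n) 0 ℚᵘ.+ toℚᵘ 1ℚ  ≈⟨ ℚᵘ.*≡* (add-one (+ n)) ⟩
    ℚᵘ.mkℚᵘ (+ suc n) 0           ∎
    where
    open ℚᵘₚ.≃-Reasoning
    add-one : ∀ i → (i ℤ.* + 1 ℤ.+ + 1 ℤ.* + 1) ℤ.* + 1 ≡ (+ 1 ℤ.+ i) ℤ.* + 1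
    add-one = solve-∀

  i≤∣i∣ : ∀ i → i ℤ.≤ + ∣ i ∣
  i≤∣i∣ (+ n)     = ℤₚ.≤-refl
  i≤∣i∣ -[1+ n ] = ℤ.-≤+

  -- a / (1 + d) < 1 + ∣a∣ because a < (1 + ∣a∣)(1 + d).
  archimedean : ∀ M → ∃ λ n → M < ones n
  archimedean (mkℚ a d _) =
    suc ∣ a ∣ ,
    toℚᵘ-cancel-< (ℚᵘₚ.<-respʳ-≃ (ℚᵘₚ.≃-sym (ones-unnormalised (suc ∣ a ∣))) (ℚᵘ.*<* cross))
    where
    open ℤₚ.≤-Reasoning
    cross : a ℤ.* + 1 ℤ.< + suc ∣ a ∣ ℤ.* + suc d
    cross = begin-strict
      a ℤ.* + 1               ≡⟨ ℤₚ.*-identityʳ a ⟩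
      a                       ≤⟨ i≤∣i∣ a ⟩
      + ∣ a ∣                 <⟨ ℤ.+<+ (ℕₚ.n<1+n ∣ a ∣) ⟩
      + suc ∣ a ∣             ≤⟨ ℤ.+≤+ (ℕₚ.m≤m*n (suc ∣ a ∣) (suc d)) ⟩
      + (suc ∣ a ∣ ℕ.* suc d) ≡⟨ ℤₚ.pos-* (suc ∣ a ∣) (suc d) ⟩
      + suc ∣ a ∣ ℤ.* + suc d ∎

  module _ (s : ℕ → ℚ) (s₀≥0 : 0ℚ ≤ s 0) (unit-step : ∀ n → s n + 1ℚ ≤ s (suc n)) where

    ones≤ : ∀ n → ones n ≤ s n
    ones≤ zero    = s₀≥0
    ones≤ (suc n) = ≤-trans (+-monoˡ-≤ 1ℚ (ones≤ n)) (unit-step n)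

    unit-steps-unbounded : ∀ M → ∃ λ n → M < s n
    unit-steps-unbounded M =
      let (n , M<n) = archimedean M in n , <-≤-trans M<n (ones≤ n)

module ReciprocalSums (lem : ExcludedMiddle 0ℓ) where
  open import Data.Nat as ℕ using (ℕ; zero; suc; z≤n; _∸_; _≤′_; ≤′-refl; ≤′-step)
  import Data.Nat.Properties as ℕₚ
  open import Data.Bool using (true; false)
  open import Data.Sum using (inj₁; inj₂)
  open import Data.Empty using (⊥-elim)
  open import Data.Rational using (ℚ; 0ℚ; 1ℚ; _+_; _≤_)
  open import Data.Rational.Properties
    using (≤-refl; ≤-reflexive; ≤-trans; <⇒≤; ≰⇒>; <-irrefl; <-≤-trans; +-mono-≤; +-monoˡ-≤;
           +-monoʳ-≤; +-identityʳ; +-assoc; nonNegative⁻¹; normalize-nonNeg;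
           +-0-commutativeMonoid; module ≤-Reasoning)
  open import Algebra.Bundles using (CommutativeMonoid)
  open import Algebra.Properties.CommutativeSemigroup
    (CommutativeMonoid.commutativeSemigroup +-0-commutativeMonoid) using (xy∙z≈xz∙y)
  open import Relation.Nullary using (¬_; yes; no)
  open import Relation.Binary.PropositionalEquality using (_≡_; refl; sym; cong; subst; module ≡-Reasoning)
  open Archimedean using (unit-steps-unbounded)
  open IntervalSequence

  recip-nonneg : ∀ m → 0ℚ ≤ recip m
  recip-nonneg m = nonNegative⁻¹ (recip m) {{normalize-nonNeg 1 (suc m)}}

  ≤-+-nonneg : ∀ p {q} → 0ℚ ≤ q → p ≤ p + q
  ≤-+-nonneg p {q} q≥0 = subst (_≤ p + q) (+-identityʳ p) (+-monoʳ-≤ p q≥0)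

  psum-step : ∀ X n → psum X n ≤ psum X (suc n)
  psum-step X n with X n
  ... | true  = ≤-+-nonneg (psum X n) (recip-nonneg n)
  ... | false = ≤-refl

  psum-mono : ∀ X {m n} → m ℕ.≤ n → psum X m ≤ psum X n
  psum-mono X m≤n = go (ℕₚ.≤⇒≤′ m≤n)
    where
    go : ∀ {m n} → m ≤′ n → psum X m ≤ psum X n
    go ≤′-refl         = ≤-refl
    go (≤′-step m≤′n) = ≤-trans (go m≤′n) (psum-step X _)

  psum-nonneg : ∀ X n → 0ℚ ≤ psum X n
  psum-nonneg X n = psum-mono X {0} {n} z≤n

  psum-⊆ : ∀ {X Y} → X ⊆ Y → ∀ n → psum X n ≤ psum Y n
  psum-⊆ X⊆Y zero = ≤-refl
  psum-⊆ {X} {Y} X⊆Y (suc n) with X n in x | Y n in y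
  ... | true  | true  = +-monoˡ-≤ (recip n) (psum-⊆ X⊆Y n)
  ... | true  | false = ⊥-elim (∈∉-absurd {Y} (X⊆Y n x) y)
  ... | false | true  = ≤-trans (psum-⊆ X⊆Y n) (≤-+-nonneg (psum Y n) (recip-nonneg n))
  ... | false | false = psum-⊆ X⊆Y n

  psum-∪ : ∀ X Y n → psum (X ∪ Y) n ≤ psum X n + psum Y n
  psum-∪ X Y zero = ≤-reflexive (sym (+-identityʳ 0ℚ))
  psum-∪ X Y (suc n) with X n | Y n
  ... | true  | true  = begin
    psum (X ∪ Y) n + recip n              ≤⟨ +-monoˡ-≤ (recip n) (psum-∪ X Y n) ⟩
    (psum X n + psum Y n) + recip n       ≡⟨ xy∙z≈xz∙y (psum X n) (psum Y n) (recip n) ⟩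
    (psum X n + recip n) + psum Y n       ≤⟨ +-monoʳ-≤ (psum X n + recip n) (≤-+-nonneg (psum Y n) (recip-nonneg n)) ⟩
    (psum X n + recip n) + (psum Y n + recip n) ∎
    where open ≤-Reasoning
  ... | true  | false = ≤-trans (+-monoˡ-≤ (recip n) (psum-∪ X Y n))
                          (≤-reflexive (xy∙z≈xz∙y (psum X n) (psum Y n) (recip n)))
  ... | false | true  = ≤-trans (+-monoˡ-≤ (recip n) (psum-∪ X Y n))
                          (≤-reflexive (+-assoc (psum X n) (psum Y n) (recip n)))
  ... | false | false = psum-∪ X Y n

  psum-bounded : ∀ {X} N → (∀ m → m ∈ X → m ℕ.< N) → ∀ n → psum X n ≤ psum X N
  psum-bounded {X} N X<N n with ℕₚ.≤-total n N
  ... | inj₁ n≤N = psum-mono X n≤N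
  ... | inj₂ N≤n = ≤-reflexive (stable (ℕₚ.≤⇒≤′ N≤n))
    where
    stable : ∀ {n} → N ≤′ n → psum X n ≡ psum X N
    stable ≤′-refl = refl
    stable {suc n} (≤′-step N≤′n) with X n in x
    ... | true  = ⊥-elim (ℕₚ.≤⇒≯ (ℕₚ.≤′⇒≤ N≤′n) (X<N n x))
    ... | false = stable N≤′n

  block : Subset → ℕ → ℕ → ℚ
  block X L zero = 0ℚ
  block X L (suc k) with X (k ℕ.+ L)
  ... | true  = block X L k + recip (k ℕ.+ L)
  ... | false = block X L k

  psum-block : ∀ X L k → psum X (k ℕ.+ L) ≡ psum X L + block X L k
  psum-block X L zero = sym (+-identityʳ (psum X L))
  psum-block X L (suc k) with X (k ℕ.+ L)
  ... | true  = begin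
    psum X (k ℕ.+ L) + recip (k ℕ.+ L)             ≡⟨ cong (_+ recip (k ℕ.+ L)) (psum-block X L k) ⟩
    (psum X L + block X L k) + recip (k ℕ.+ L)     ≡⟨ +-assoc (psum X L) (block X L k) (recip (k ℕ.+ L)) ⟩
    psum X L + (block X L k + recip (k ℕ.+ L))     ∎
    where open ≡-Reasoning
  ... | false = psum-block X L k

  block-mono : ∀ {X Y} L k → (∀ m → L ℕ.≤ m → m ℕ.< k ℕ.+ L → m ∈ X → m ∈ Y) →
               block X L k ≤ block Y L k
  block-mono L zero _ = ≤-refl
  block-mono {X} {Y} L (suc k) X⊆Y =
    extend (block-mono L k λ m L≤m m<k+L → X⊆Y m L≤m (ℕₚ.m<n⇒m<1+n m<k+L))
    where
    extend : block X L k ≤ block Y L k → block X L (suc k) ≤ block Y L (suc k)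
    extend IH with X (k ℕ.+ L) in x | Y (k ℕ.+ L) in y
    ... | true  | true  = +-monoˡ-≤ (recip (k ℕ.+ L)) IH
    ... | true  | false = ⊥-elim (∈∉-absurd {Y} (X⊆Y (k ℕ.+ L) (ℕₚ.m≤n+m L k) ℕₚ.≤-refl x) y)
    ... | false | true  = ≤-trans IH (≤-+-nonneg (block Y L k) (recip-nonneg (k ℕ.+ L)))
    ... | false | false = IH

  Weighty : Subset → ℕ → ℕ → Set
  Weighty X L R = ∃ λ k → R ≡ k ℕ.+ L × 1ℚ ≤ block X L k

  weighty-mono : ∀ {X Y L R} → (∀ m → L ℕ.≤ m → m ℕ.< R → m ∈ X → m ∈ Y) →
                 Weighty X L R → Weighty Y L R
  weighty-mono X⊆Y (k , refl , 1≤block) = k , refl , ≤-trans 1≤block (block-mono _ k X⊆Y)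

  weighty-gain : ∀ {X L R} → Weighty X L R → psum X L + 1ℚ ≤ psum X R
  weighty-gain {X} {L} (k , refl , 1≤block) =
    subst (psum X L + 1ℚ ≤_) (sym (psum-block X L k)) (+-monoʳ-≤ (psum X L) 1≤block)

  -- If no interval beyond L is weighty, the partial sums stay below psum X L + 1.
  weighty-beyond : ∀ {X} → ¬ rcp X → ∀ L → ∃ λ R → L ℕ.≤ R × Weighty X L R
  weighty-beyond {X} X-divergent L with lem {∃ λ k → 1ℚ ≤ block X L k}
  ... | yes (k , 1≤block) = k ℕ.+ L , ℕₚ.m≤n+m L k , k , refl , 1≤block
  ... | no light = ⊥-elim (X-divergent (psum X L + 1ℚ , bound))
    where
    open ≤-Reasoning
    n≤n∸L+L : ∀ n → n ℕ.≤ (n ∸ L) ℕ.+ L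
    n≤n∸L+L n = ℕₚ.≤-trans (ℕₚ.m≤n+m∸n n L) (ℕₚ.≤-reflexive (ℕₚ.+-comm L (n ∸ L)))

    bound : ∀ n → psum X n ≤ psum X L + 1ℚ
    bound n = begin
      psum X n                     ≤⟨ psum-mono X (n≤n∸L+L n) ⟩
      psum X ((n ∸ L) ℕ.+ L)       ≡⟨ psum-block X L (n ∸ L) ⟩
      psum X L + block X L (n ∸ L) ≤⟨ +-monoʳ-≤ (psum X L) (<⇒≤ (≰⇒> λ 1≤block → light (n ∸ L , 1≤block))) ⟩
      psum X L + 1ℚ                ∎

  weighty-often⇒divergent : ∀ {A} (J : IntervalSequence) →
                            (∀ n → Weighty A (left J n) (right J n)) → ¬ rcp A
  weighty-often⇒divergent {A} J weighty (M , A≤M) =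
    let (n , M<s) = unit-steps-unbounded s (psum-nonneg A (left J 0)) unit-step M
    in <-irrefl refl (<-≤-trans M<s (A≤M (left J n)))
    where
    s : ℕ → ℚ
    s n = psum A (left J n)
    unit-step : ∀ n → s n + 1ℚ ≤ s (suc n)
    unit-step n = ≤-trans (weighty-gain (weighty n)) (psum-mono A (right≤left J n))

  rcp-ideal : HeavyIntervalIdeal rcp
  rcp-ideal = record
    { downward      = λ X⊆Y (M , Y≤M) → M , λ n → ≤-trans (psum-⊆ X⊆Y n) (Y≤M n)
    ; ∪-closed      = λ {X} {Y} (M₁ , X≤M₁) (M₂ , Y≤M₂) →
                        M₁ + M₂ , λ n → ≤-trans (psum-∪ X Y n) (+-mono-≤ (X≤M₁ n) (Y≤M₂ n))
    ; bounded∈      = λ {X} N X<N → psum X N , psum-bounded N X<N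
    ; Heavy         = Weighty
    ; heavy-beyond  = weighty-beyond
    ; heavy-mono    = weighty-mono
    ; heavy-often⇒∉ = weighty-often⇒divergent
    }

corollary2p5 : ExcludedMiddle 0ℓ →
    DiagonalIntersectionProperty fin × DiagonalIntersectionProperty rcp
corollary2p5 lem =
  diagonal-intersection (FiniteSets.fin-ideal lem) ,
  diagonal-intersection (ReciprocalSums.rcp-ideal lem)
  where open DiagonalIntersection lem
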